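{- Let $U$ and $n$ be positive integers and let $w > \lg U$. Consider the rank problem on universe $[U]$ restricted to databases $S \subseteq [U]$ with $|S| = n$, i.e. the data structure problem $f(x,S) = |\{s \in S : s \le x\}|$ for queries $x \in [U]$. This problem has $(n, w, 2)$-certificates.
   Context: A data structure problem is a function $f : \mathcal{Q} \times \mathcal{D} \to \mathcal{Z}$ (queries $\mathcal{Q}$, databases $\mathcal{D}$, results $\mathcal{Z}$). For a code $T : \mathcal{D} \to (\{0,1\}^w)^s$, write $T_d(i)$ for the $i$-th of the $s$ cells ($w$-bit strings) of $T(d)$, and for $P = \{i_1,\dots,i_k\} \subseteq \{1,\dots,s\}$ write $T_d(P)$ for the sequence $(i_1, T_d(i_1)),\dots,(i_k, T_d(i_k))$. The problem $f$ has $(s,w,t)$-certificates if there exist a code $T : \mathcal{D} \to (\{0,1\}^w)^s$ and a verifier $V$ such that for all $q \in \mathcal{Q}$, $d \in \mathcal{D}$ and all $P \subseteq \{1,\dots,s\}$ with $|P| = t$, either $V(q, T_d(P)) = f(q,d)$ or $V(q, T_d(P)) = \bot$ (where $\bot \notin \mathcal{Z}$ denotes failure), and for at least one such $P$ we have $V(q, T_d(P)) = f(q,d)$. (Equivalently: a non-deterministic data structure with $s$ cells of $w$ bits answering each query by guessing $t$ cells.) -}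

module Defs where

open import Data.Nat using (ℕ; _≤_; _<_; _^_)
open import Data.Bool using (Bool)
open import Data.Fin using (Fin) renaming (_≤?_ to _≤ᶠ?_)
open import Data.Fin.Subset using (Subset; ∣_∣; _∩_; _∈_; inside)
open import Data.Fin.Subset.Properties using (_∈?_)
open import Data.Vec using (Vec; tabulate)
open import Data.List using (List; filter; map)
open import Data.List.Base using ()
open import Data.Fin.Base using ()
open import Data.Maybe using (Maybe; just; nothing)
open import Data.Product using (Σ; ∃; _×_; _,_)
open import Data.Sum using (_⊎_)
open import Relation.Binary.PropositionalEquality using (_≡_)
open import Relation.Nullary using (does)
open import Data.List using (allFin)

Cell : ℕ → Set
Cell w = Vec Bool w

probe : ∀ {s w} → (Fin s → Cell w) → Subset s → List (Fin s × Cell w)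
probe {s} c P = map (λ i → i , c i) (filter (λ i → i ∈? P) (allFin s))

-- (s,w,t)-certificates for a data structure problem f : Q × D → Z.
-- The verifier returns 'nothing' for failure (⊥) and 'just z' for an answer z.
record HasCertificates {Q D Z : Set} (f : Q → D → Z) (s w t : ℕ) : Set where
  field
    T : D → Fin s → Cell w
    V : Q → List (Fin s × Cell w) → Maybe Z
    sound : ∀ (q : Q) (d : D) (P : Subset s) → ∣ P ∣ ≡ t →
            (V q (probe (T d) P) ≡ just (f q d)) ⊎ (V q (probe (T d) P) ≡ nothing)
    complete : ∀ (q : Q) (d : D) →
               Σ (Subset s) (λ P → (∣ P ∣ ≡ t) × (V q (probe (T d) P) ≡ just (f q d)))

Database : ℕ → ℕ → Set
Database U n = Σ (Subset U) (λ S → ∣ S ∣ ≡ n)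

rank : ∀ {U n} → Fin U → Database U n → ℕ
rank {U} x (S , _) = ∣ S ∩ tabulate (λ i → toSide (does (i ≤ᶠ? x))) ∣
  where
  open import Data.Fin.Subset using (Side; outside)
  toSide : Bool → Side
  toSide Bool.true = inside
  toSide Bool.false = outside

module Submission where

-- Cell k stores, in binary, the k-th smallest element s_k of S, i.e. the least t with k < rank t S,
-- so that s_k ≤ x ⇔ k < rank x S.  A probed cell (k, s_k) thus shows rank x S ≥ k + 1 when s_k ≤ x
-- and rank x S ≤ k otherwise.  The verifier intersects these bounds with [0, n] and answers only when
-- the interval is a single point, which is always sound; probing the cells r − 1 and r around the
-- answer r (two adjacent cells inside [0, n), as n ≥ 2) makes the interval exactly {r}.

open import Defs
open import Data.Nat using (ℕ; zero; suc; _+_; _≤ᵇ_; _≤_; _<_; _^_; z≤n; s≤s; _≟_; _≤?_)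
open import Data.Nat.Properties
  using ( ≤ᵇ⇒≤; ≤⇒≤ᵇ; ≤-reflexive; ≤-trans; ≤-antisym; <-irrefl; <-≤-trans; <⇒≤; <⇒≱; ≰⇒>; ≮⇒≥
        ; m≤n⇒m<n∨m≡n; ≤-totalOrder)
open import Data.Bool using (true; false)
open import Data.Empty using (⊥-elim)
open import Data.Fin as Fin using (Fin; toℕ; fromℕ; fromℕ<; inject₁; inject≤; funToFin; finToFun)
open import Data.Fin.Properties
  using ( 2↔Bool; funToFin-finToFin; toℕ-injective; toℕ-inject; toℕ-inject₁; toℕ-inject≤; toℕ-fromℕ
        ; toℕ-fromℕ<; toℕ<n; ≤fromℕ; ¬∀⟶∃¬-smallest)
open import Data.Fin.Subset using (Subset; Side; inside; ∣_∣; _∩_; _∪_; _∈_; ⁅_⁆; ⊥)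
open import Data.Fin.Subset.Properties
  using (_∈?_; p⊆q⇒∣p∣≤∣q∣; x∈p∩q⁺; x∈p∩q⁻; ∣p∩q∣≤∣p∣; x∈p∪q⁺; x∈⁅x⁆; ∣⊥∣≡0; ∪-identityˡ)
open import Data.Vec using (tabulate; lookup)
open import Data.Vec.Properties using (lookup∘tabulate; []=⇒lookup; lookup⇒[]=)
open import Data.List using (List; map)
open import Data.List.Extrema ≤-totalOrder using (max; min; max≤v⁺; v≤max⁺; min≤v⁺; v≤min⁺)
open import Data.List.Relation.Unary.All as All using (All)
open import Data.List.Relation.Unary.All.Properties as All using ()
open import Data.List.Relation.Unary.Any as Any using (Any)
open import Data.List.Relation.Unary.Any.Properties as Any using ()
open import Data.List.Membership.Propositional using (lose)
open import Data.List.Membership.Propositional.Properties using (∈-filter⁺; ∈-allFin)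
open import Data.Maybe using (Maybe; just; nothing)
open import Data.Product using (∃; _×_; _,_; proj₁; proj₂)
open import Data.Sum as Sum using (_⊎_; inj₁; inj₂)
open import Function using (_∘_; Inverse; _⇔_; mk⇔; Equivalence)
open import Function.Construct.Composition using (_⇔-∘_)
open import Relation.Binary using (_Preserves_⟶_)
open import Relation.Binary.PropositionalEquality using (_≡_; _≗_; refl; sym; trans; cong; cong₂; subst)
open import Relation.Nullary using (yes; no; contradiction)

open Equivalence using (to; from)

funToFin-cong : ∀ {m n} {f g : Fin m → Fin n} → f ≗ g → funToFin f ≡ funToFin g
funToFin-cong {zero}  f≗g = refl
funToFin-cong {suc m} f≗g = cong₂ Fin.combine (f≗g Fin.zero) (funToFin-cong (f≗g ∘ Fin.suc))

encode : ∀ {w} → Fin (2 ^ w) → Cell w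
encode i = tabulate (Inverse.to 2↔Bool ∘ finToFun i)

decode : ∀ {w} → Cell w → Fin (2 ^ w)
decode c = funToFin (Inverse.from 2↔Bool ∘ lookup c)

decode-encode : ∀ {w} (i : Fin (2 ^ w)) → decode (encode {w} i) ≡ i
decode-encode {w} i = trans (funToFin-cong bitwise) (funToFin-finToFin {w} {2} i)
  where
  bitwise : Inverse.from 2↔Bool ∘ lookup (encode {w} i) ≗ finToFun {2} {w} i
  bitwise j = trans (cong (Inverse.from 2↔Bool) (lookup∘tabulate _ j))
                    (Inverse.strictlyInverseʳ 2↔Bool (finToFun i j))

value : ∀ {w} → Cell w → ℕ
value c = toℕ (decode c)

threshold : ∀ {U} (f : Fin U → ℕ) → f Preserves Fin._≤_ ⟶ _≤_ →
            ∀ k {y} → k < f y → ∃ λ t → ∀ x → t Fin.≤ x ⇔ k < f x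
threshold {U} f f-mono k {y} k<fy
  with ¬∀⟶∃¬-smallest U (λ x → f x ≤ k) (λ x → f x ≤? k) (λ ∀fx≤k → <⇒≱ k<fy (∀fx≤k y))
... | t , ft≰k , ∀below-t = t , λ x → mk⇔ above (λ k<fx → ≮⇒≥ (<⇒≱ k<fx ∘ below))
  where
  above : ∀ {x} → t Fin.≤ x → k < f x
  above t≤x = <-≤-trans (≰⇒> ft≰k) (f-mono t≤x)
  below : ∀ {x} → x Fin.< t → f x ≤ k
  below x<t = subst (λ z → f z ≤ k) (toℕ-injective (trans (toℕ-inject _) (toℕ-fromℕ< x<t)))
                    (∀below-t (fromℕ< x<t))

-- `rank` builds {i | i ≤ x} as `tabulate h` with a conversion Bool → Side that is local to Defs;
-- unifying against `refl` recovers `h`.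
≤-side : ∀ {U n} → Fin U → Database U n → Fin U → Side
≤-side x d = tabulated {S = proj₁ d} (refl {x = rank x d})
  where
  tabulated : ∀ {U} {S : Subset U} {h : Fin U → Side} {m} → m ≡ ∣ S ∩ tabulate h ∣ → Fin U → Side
  tabulated {h = h} _ = h

≤-side≡inside : ∀ {U n} {i x : Fin U} (d : Database U n) → ≤-side x d i ≡ inside ⇔ i Fin.≤ x
≤-side≡inside {i = i} {x} d with toℕ i ≤ᵇ toℕ x | ≤ᵇ⇒≤ (toℕ i) (toℕ x) | ≤⇒≤ᵇ {toℕ i} {toℕ x}
... | true  | i≤x | _   = mk⇔ (λ _ → i≤x _) (λ _ → refl)
... | false | _   | i≰x = mk⇔ (λ ()) (⊥-elim ∘ i≰x)

∈-tabulate : ∀ {U} {h : Fin U → Side} {i} → i ∈ tabulate h ⇔ h i ≡ inside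
∈-tabulate {h = h} {i} = mk⇔ (λ i∈ → trans (sym (lookup∘tabulate h i)) ([]=⇒lookup i∈))
                             (λ hi → lookup⇒[]= i _ (trans (lookup∘tabulate h i) hi))

atMost : ∀ {U n} → Fin U → Database U n → Subset U
atMost x d = tabulate (≤-side x d)

∈-atMost : ∀ {U n} {i x : Fin U} (d : Database U n) → i ∈ atMost x d ⇔ i Fin.≤ x
∈-atMost d = ≤-side≡inside d ⇔-∘ ∈-tabulate

rank-mono : ∀ {U n} (d : Database U n) → (λ x → rank x d) Preserves Fin._≤_ ⟶ _≤_
rank-mono d@(S , _) {x} {y} x≤y = p⊆q⇒∣p∣≤∣q∣ {p = S ∩ atMost x d} {q = S ∩ atMost y d} λ i∈ →
  let i∈S , i≤x = x∈p∩q⁻ S (atMost x d) i∈ in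
  x∈p∩q⁺ (i∈S , from (∈-atMost d) (≤-trans (to (∈-atMost d) i≤x) x≤y))

rank≤size : ∀ {U n} (x : Fin U) (d : Database U n) → rank x d ≤ n
rank≤size x d@(S , ∣S∣≡n) = subst (rank x d ≤_) ∣S∣≡n (∣p∩q∣≤∣p∣ S _)

size≤rank-last : ∀ {U n} (d : Database (suc U) n) → n ≤ rank (fromℕ U) d
size≤rank-last {U} d@(S , ∣S∣≡n) = subst (_≤ rank (fromℕ U) d) ∣S∣≡n
  (p⊆q⇒∣p∣≤∣q∣ {p = S} {q = S ∩ atMost (fromℕ U) d} λ {i} i∈S →
    x∈p∩q⁺ (i∈S , from (∈-atMost d) (≤fromℕ i)))

order-statistic : ∀ {U n} (d : Database (suc U) n) (k : Fin n) →
                  ∃ λ t → ∀ x → t Fin.≤ x ⇔ toℕ k < rank x d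
order-statistic {U} d k =
  threshold (λ x → rank x d) (rank-mono d) (toℕ k) {fromℕ U} (<-≤-trans (toℕ<n k) (size≤rank-last d))

cells : ∀ {U n w} → suc U ≤ 2 ^ w → Database (suc U) n → Fin n → Cell w
cells U≤2^w d k = encode (inject≤ (proj₁ (order-statistic d k)) U≤2^w)

cells-threshold : ∀ {U n w} (U≤2^w : suc U ≤ 2 ^ w) (d : Database (suc U) n) k x →
                  value (cells {w = w} U≤2^w d k) ≤ toℕ x ⇔ toℕ k < rank x d
cells-threshold {w = w} U≤2^w d k x =
  subst (λ v → v ≤ toℕ x ⇔ toℕ k < rank x d) (sym value≡) (proj₂ (order-statistic d k) x)
  where
  value≡ : value (cells {w = w} U≤2^w d k) ≡ toℕ (proj₁ (order-statistic d k))
  value≡ = trans (cong toℕ (decode-encode {w} _)) (toℕ-inject≤ _ U≤2^w)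

probe-all : ∀ {s w} (c : Fin s → Cell w) (P : Subset s) {Q : Fin s × Cell w → Set} →
            (∀ k → Q (k , c k)) → All Q (probe c P)
probe-all c P q = All.map⁺ (All.universal q _)

probe-any : ∀ {s w} (c : Fin s → Cell w) {P : Subset s} {Q : Fin s × Cell w → Set} {k} →
            k ∈ P → Q (k , c k) → Any Q (probe c P)
probe-any c k∈P q = Any.map⁺ (lose (∈-filter⁺ (_∈? _) (∈-allFin _) k∈P) q)

pinned : ℕ → ℕ → Maybe ℕ
pinned lo hi with lo ≟ hi
... | yes _ = just lo
... | no  _ = nothing

pinned-sound : ∀ {lo hi r} → lo ≤ r → r ≤ hi → pinned lo hi ≡ just r ⊎ pinned lo hi ≡ nothing
pinned-sound {lo} {hi} lo≤r r≤hi with lo ≟ hi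
... | yes refl = inj₁ (cong just (≤-antisym lo≤r r≤hi))
... | no  _    = inj₂ refl

pinned-complete : ∀ {lo hi r} → lo ≡ r → hi ≡ r → pinned lo hi ≡ just r
pinned-complete {r = r} refl refl with r ≟ r
... | yes _  = refl
... | no r≢r = contradiction refl r≢r

module _ {U n w : ℕ} (x : Fin U) where

  lowerBound : Fin n × Cell w → ℕ
  lowerBound (k , c) with value c ≤? toℕ x
  ... | yes _ = suc (toℕ k)
  ... | no  _ = 0

  upperBound : Fin n × Cell w → ℕ
  upperBound (k , c) with value c ≤? toℕ x
  ... | yes _ = n
  ... | no  _ = toℕ k

  verify : List (Fin n × Cell w) → Maybe ℕ
  verify L = pinned (max 0 (map lowerBound L)) (min n (map upperBound L))

Brackets : ∀ {n} → ℕ → Subset n → Set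
Brackets {n} r P = (r ≡ 0 ⊎ ∃ λ k → k ∈ P × suc (toℕ k) ≡ r) × (r ≡ n ⊎ ∃ λ k → k ∈ P × toℕ k ≡ r)

module Verification {U n w : ℕ} (c : Fin n → Cell w) (r : Fin U → ℕ) (r≤n : ∀ x → r x ≤ n)
                    (c-threshold : ∀ k x → value (c k) ≤ toℕ x ⇔ toℕ k < r x) (x : Fin U) where

  lowerBound-sound : ∀ k → lowerBound x (k , c k) ≤ r x
  lowerBound-sound k with value (c k) ≤? toℕ x
  ... | yes v≤x = to (c-threshold k x) v≤x
  ... | no  _   = z≤n

  upperBound-sound : ∀ k → r x ≤ upperBound x (k , c k)
  upperBound-sound k with value (c k) ≤? toℕ x
  ... | yes _   = r≤n x
  ... | no  v≰x = ≮⇒≥ (v≰x ∘ from (c-threshold k x))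

  lowerBound-exact : ∀ k → suc (toℕ k) ≡ r x → r x ≤ lowerBound x (k , c k)
  lowerBound-exact k 1+k≡r with value (c k) ≤? toℕ x
  ... | yes _   = ≤-reflexive (sym 1+k≡r)
  ... | no  v≰x = contradiction (from (c-threshold k x) (≤-reflexive 1+k≡r)) v≰x

  upperBound-exact : ∀ k → toℕ k ≡ r x → upperBound x (k , c k) ≤ r x
  upperBound-exact k k≡r with value (c k) ≤? toℕ x
  ... | yes v≤x = contradiction (to (c-threshold k x) v≤x) (<-irrefl k≡r)
  ... | no  _   = ≤-reflexive k≡r

  module _ (P : Subset n) where

    lo hi : ℕ
    lo = max 0 (map (lowerBound x) (probe c P))
    hi = min n (map (upperBound x) (probe c P))

    lo≤r : lo ≤ r x
    lo≤r = max≤v⁺ z≤n (All.map⁺ (probe-all c P lowerBound-sound))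

    r≤hi : r x ≤ hi
    r≤hi = v≤min⁺ (r≤n x) (All.map⁺ (probe-all c P upperBound-sound))

    verify-sound : verify x (probe c P) ≡ just (r x) ⊎ verify x (probe c P) ≡ nothing
    verify-sound = pinned-sound lo≤r r≤hi

    verify-complete : Brackets (r x) P → verify x (probe c P) ≡ just (r x)
    verify-complete (below , above) = pinned-complete (≤-antisym lo≤r r≤lo) (≤-antisym hi≤r r≤hi)
      where
      r≤lo : r x ≤ lo
      r≤lo = v≤max⁺ 0 _ (Sum.map ≤-reflexive
        (λ (k , k∈P , 1+k≡r) → Any.map⁺ (probe-any c k∈P (lowerBound-exact k 1+k≡r))) below)
      hi≤r : hi ≤ r x
      hi≤r = min≤v⁺ n _ (Sum.map (≤-reflexive ∘ sym)
        (λ (k , k∈P , k≡r) → Any.map⁺ (probe-any c k∈P (upperBound-exact k k≡r))) above)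

adjacent : ∀ {m} → Fin (suc m) → Subset (suc (suc m))
adjacent k = ⁅ inject₁ k ⁆ ∪ ⁅ Fin.suc k ⁆

∣adjacent∣≡2 : ∀ {m} (k : Fin (suc m)) → ∣ adjacent k ∣ ≡ 2
∣adjacent∣≡2 {m}     Fin.zero    = cong (2 +_) (trans (cong ∣_∣ (∪-identityˡ (⊥ {m}))) (∣⊥∣≡0 m))
∣adjacent∣≡2 {suc m} (Fin.suc k) = ∣adjacent∣≡2 k

inject₁∈adjacent : ∀ {m} (k : Fin (suc m)) → inject₁ k ∈ adjacent k
inject₁∈adjacent k = x∈p∪q⁺ (inj₁ (x∈⁅x⁆ (inject₁ k)))

suc∈adjacent : ∀ {m} (k : Fin (suc m)) → Fin.suc k ∈ adjacent k
suc∈adjacent k = x∈p∪q⁺ (inj₂ (x∈⁅x⁆ (Fin.suc k)))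

brackets-adjacent : ∀ {m} r → r ≤ suc (suc m) → ∃ λ (k : Fin (suc m)) → Brackets r (adjacent k)
brackets-adjacent zero _ = Fin.zero , inj₁ refl , inj₂ (Fin.zero , inject₁∈adjacent Fin.zero , refl)
brackets-adjacent {m} (suc r) 1+r≤2+m with m≤n⇒m<n∨m≡n 1+r≤2+m
... | inj₁ (s≤s r<1+m) =
  k , inj₂ (inject₁ k , inject₁∈adjacent k , cong suc (trans (toℕ-inject₁ k) (toℕ-fromℕ< r<1+m)))
    , inj₂ (Fin.suc k , suc∈adjacent k , cong suc (toℕ-fromℕ< r<1+m))
  where k = fromℕ< r<1+m
... | inj₂ refl =
  fromℕ m , inj₂ (Fin.suc (fromℕ m) , suc∈adjacent (fromℕ m) , cong (suc ∘ suc) (toℕ-fromℕ m)) , inj₁ refl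

threshold-certificates : ∀ {U n w} {D : Set} (f : Fin U → D → ℕ) → 2 ≤ n → (∀ x d → f x d ≤ n) →
                         (c : D → Fin n → Cell w) → (∀ d k x → value (c d k) ≤ toℕ x ⇔ toℕ k < f x d) →
                         HasCertificates f n w 2
threshold-certificates f (s≤s (s≤s _)) f≤n c c-threshold = record
  { T        = c
  ; V        = verify
  ; sound    = λ x d P _ → verify-sound x d P
  ; complete = λ x d → let k , brackets = brackets-adjacent (f x d) (f≤n x d) in
                       adjacent k , ∣adjacent∣≡2 k , verify-complete x d (adjacent k) brackets
  }
  where
  module V x d = Verification (c d) (λ y → f y d) (λ y → f≤n y d) (c-threshold d) x
  open V using (verify-sound; verify-complete)

lemma1 : (U n w : ℕ) → 1 ≤ U → 2 ≤ n → U < 2 ^ w →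
    HasCertificates (rank {U} {n}) n w 2
lemma1 (suc U) n w _ 2≤n U<2^w =
  threshold-certificates rank 2≤n rank≤size (cells (<⇒≤ U<2^w)) (cells-threshold {w = w} (<⇒≤ U<2^w))
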